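{- Let $L_2$ be the language over $\{a,b,c\}$ consisting of all words $a_1\cdots a_n$ with $n\geq1$, $a_1\in\{a,b\}$, $a_i\in\{b,c\}$ for all positions $i$ strictly between the first and the last in the sense of the definition below, and $a_n\in\{a,c\}$; i.e. $L_2$ is the strictly locally $1$-testable language with $B=\{a,b\}$, $I=\{b,c\}$, $E=\{a,c\}$, $F=\emptyset$. Then $L_2\in\mathrm{SLT}_1\setminus\mathrm{REG}_4^Z$.
   Context: For $k\geq1$, a language $L$ over an alphabet $V$ is strictly locally $k$-testable (family $\mathrm{SLT}_k$) if there are sets $B,I,E\subseteq V^k$ and a finite set $F$ of words of length at most $k-1$ such that $L$ consists of the words of $F$ together with exactly those words $a_1a_2\cdots a_n$ ($n\geq k$, $a_i\in V$) for which $a_1\cdots a_k\in B$, $a_{j+1}\cdots a_{j+k}\in I$ for every $j$ with $1\leq j\leq n-k-1$, and $a_{n-k+1}\cdots a_n\in E$; this language is denoted by the data $(B,I,E,F)$. $\mathrm{REG}_n^Z$ is the family of regular languages accepted by some deterministic finite automaton (with total transition function) with at most $n$ states. -}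

module Defs where

open import Data.Nat using (ℕ; _≤_; _+_; _∸_)
open import Data.Fin using (Fin)
open import Data.Bool using (Bool; true)
open import Data.List using (List; []; _∷_; length; take; drop; foldl)
open import Data.List.Membership.Propositional using (_∈_)
open import Data.List.Relation.Unary.All using (All)
open import Data.Product using (Σ; _×_; ∃)
open import Data.Sum using (_⊎_)
open import Data.Empty using (⊥)
open import Level using (Level; suc; zero)
open import Relation.Binary.PropositionalEquality using (_≡_)

Language : Set → Set₁
Language V = List V → Set

_≐_ : {V : Set} → Language V → Language V → Set
L ≐ M = ∀ w → (L w → M w) × (M w → L w)

-- The language denoted by the data (B, I, E, F) for parameter k:
-- the words of F, together with the words a₁⋯aₙ (n ≥ k) with
-- a₁⋯a_k ∈ B, a_{j+1}⋯a_{j+k} ∈ I for 1 ≤ j ≤ n-k-1, a_{n-k+1}⋯aₙ ∈ E.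
-- (0-indexed, a_{j+1}⋯a_{j+k} = take k (drop j w); j ≤ n-k-1 ⇔ j+k+1 ≤ n.)
SLTLang : {V : Set} (k : ℕ) (B I E : List V → Set) (F : List (List V)) → Language V
SLTLang k B I E F w =
  (w ∈ F) ⊎
  ( (k ≤ length w)
  × B (take k w)
  × (∀ j → 1 ≤ j → j + k + 1 ≤ length w → I (take k (drop j w)))
  × E (drop (length w ∸ k) w) )

SLT : {V : Set} (k : ℕ) → Language V → Set₁
SLT {V} k L =
  Σ (List V → Set) λ B →
  Σ (List V → Set) λ I →
  Σ (List V → Set) λ E →
  Σ (List (List V)) λ F →
    (∀ u → B u → length u ≡ k) ×
    (∀ u → I u → length u ≡ k) ×
    (∀ u → E u → length u ≡ k) ×
    All (λ u → length u + 1 ≤ k) F ×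
    (L ≐ SLTLang k B I E F)

record DFA (V : Set) (m : ℕ) : Set where
  field
    start  : Fin m
    δ      : Fin m → V → Fin m
    accept : Fin m → Bool

Accepted : {V : Set} {m : ℕ} → DFA V m → Language V
Accepted A w = DFA.accept A (foldl (DFA.δ A) (DFA.start A) w) ≡ true

REG : {V : Set} (n : ℕ) → Language V → Set
REG {V} n L = Σ ℕ λ m → (m ≤ n) × Σ (DFA V m) λ A → L ≐ Accepted A

data Σ₃ : Set where
  a b c : Σ₃

InB InI InE : Σ₃ → Set
InB x = (x ≡ a) ⊎ (x ≡ b)
InI x = (x ≡ b) ⊎ (x ≡ c)
InE x = (x ≡ a) ⊎ (x ≡ c)

L2-tail : List Σ₃ → Set
L2-tail [] = ⊥
L2-tail (y ∷ []) = InE y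
L2-tail (y ∷ z ∷ zs) = InI y × L2-tail (z ∷ zs)

L2 : Language Σ₃
L2 [] = ⊥
L2 (x ∷ []) = InB x × InE x
L2 (x ∷ y ∷ zs) = InB x × L2-tail (y ∷ zs)

{-# OPTIONS --safe #-}
module Submission where

-- It needs five states: for w = ε, a, b, c, aa the memberships of w, wa, wc in L₂ form five
-- distinct patterns, whereas two words read into the same state of a DFA agree on every
-- continuation; with four states, pigeonhole gives a collision.

open import Defs
open import Data.Bool using (Bool; true; false)
open import Data.Empty using (⊥)
open import Data.Fin using (Fin; zero; suc; _≟_)
open import Data.Fin.Properties using (pigeonhole; <⇒≢; all?)
open import Data.List using (List; []; _∷_; length; take; drop; foldl; map; _++_)
open import Data.List.Properties using (foldl-++; map-cong; ≡-dec)
open import Data.List.Relation.Unary.All using ([])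
open import Data.Nat using (ℕ; zero; suc; _+_; _∸_; _≤_; z≤n; s≤s)
open import Data.Product using (_×_; _,_; proj₁; proj₂)
open import Data.Sum using (inj₁; inj₂)
open import Function using (_∘_)
open import Function.Definitions using (Injective)
open import Relation.Binary.PropositionalEquality using (_≡_; refl; cong; module ≡-Reasoning)
open import Relation.Nullary using (¬_; yes; no; does)
open import Relation.Nullary.Decidable using (dec-true; dec-false; from-yes; _×-dec_; _→-dec_)
open import Relation.Unary using (Decidable)

import Data.Bool.Properties as Bool

Letter : {V : Set} → (V → Set) → Language V
Letter P (x ∷ []) = P x
Letter P _        = ⊥

Letter-length : {V : Set} (P : V → Set) (u : List V) → Letter P u → length u ≡ 1
Letter-length P (x ∷ []) _ = refl

SLT₁Lang : Language Σ₃
SLT₁Lang = SLTLang 1 (Letter InB) (Letter InI) (Letter InE) []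

L2-tail⇒interior : ∀ t → L2-tail t →
  ∀ j → j + 1 + 1 ≤ length t → Letter InI (take 1 (drop j t))
L2-tail⇒interior (y ∷ [])     _         zero          (s≤s ())
L2-tail⇒interior (y ∷ [])     _         (suc zero)    (s≤s ())
L2-tail⇒interior (y ∷ [])     _         (suc (suc _)) (s≤s ())
L2-tail⇒interior (y ∷ z ∷ zs) (y∈I , _) zero          _         = y∈I
L2-tail⇒interior (y ∷ z ∷ zs) (_ , t)   (suc j)       (s≤s j<n) = L2-tail⇒interior (z ∷ zs) t j j<n

L2-tail⇒last : ∀ t → L2-tail t → Letter InE (drop (length t ∸ 1) t)
L2-tail⇒last (y ∷ [])     y∈E     = y∈E
L2-tail⇒last (y ∷ z ∷ zs) (_ , t) = L2-tail⇒last (z ∷ zs) t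

interior×last⇒L2-tail : ∀ y zs →
  (∀ j → j + 1 + 1 ≤ length (y ∷ zs) → Letter InI (take 1 (drop j (y ∷ zs)))) →
  Letter InE (drop (length (y ∷ zs) ∸ 1) (y ∷ zs)) → L2-tail (y ∷ zs)
interior×last⇒L2-tail y []       _        last = last
interior×last⇒L2-tail y (z ∷ zs) interior last =
  interior zero (s≤s (s≤s z≤n)) ,
  interior×last⇒L2-tail z zs (λ j j<n → interior (suc j) (s≤s j<n)) last

L2⇒SLT₁Lang : ∀ w → L2 w → SLT₁Lang w
L2⇒SLT₁Lang (x ∷ []) (x∈B , x∈E) =
  inj₂ (s≤s z≤n , x∈B , (λ { (suc zero) _ (s≤s ()) ; (suc (suc _)) _ (s≤s ()) }) , x∈E)
L2⇒SLT₁Lang (x ∷ y ∷ zs) (x∈B , t) =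
  inj₂ (s≤s z≤n , x∈B , interior , L2-tail⇒last (y ∷ zs) t)
  where
  interior : ∀ j → 1 ≤ j → j + 1 + 1 ≤ length (x ∷ y ∷ zs) →
             Letter InI (take 1 (drop j (x ∷ y ∷ zs)))
  interior (suc j) _ (s≤s j<n) = L2-tail⇒interior (y ∷ zs) t j j<n

SLT₁Lang⇒L2 : ∀ w → SLT₁Lang w → L2 w
SLT₁Lang⇒L2 (x ∷ [])     (inj₂ (_ , x∈B , _ , x∈E))         = x∈B , x∈E
SLT₁Lang⇒L2 (x ∷ y ∷ zs) (inj₂ (_ , x∈B , interior , last)) =
  x∈B , interior×last⇒L2-tail y zs (λ j j<n → interior (suc j) (s≤s z≤n) (s≤s j<n)) last

L2∈SLT₁ : SLT 1 L2
L2∈SLT₁ =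
  Letter InB , Letter InI , Letter InE , [] ,
  Letter-length InB , Letter-length InI , Letter-length InE , [] ,
  λ w → L2⇒SLT₁Lang w , SLT₁Lang⇒L2 w

module _ {V : Set} {m : ℕ} (A : DFA V m) where
  open DFA A

  state : List V → Fin m
  state = foldl δ start

  state-++ : ∀ u s → state (u ++ s) ≡ foldl δ (state u) s
  state-++ u s = foldl-++ δ start u s

  accepts-does : {L : Language V} (L? : Decidable L) → L ≐ Accepted A →
                 ∀ w → does (L? w) ≡ accept (state w)
  accepts-does L? L≐A w with accept (state w) in eq
  ... | true  = dec-true (L? w) (proj₂ (L≐A w) eq)
  ... | false = dec-false (L? w) (λ w∈L → Bool.not-¬ (proj₁ (L≐A w) w∈L) eq)

-- A finite approximation of the Nerode class of u: which u ++ s, for the test suffixes s, lie in L.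
signature : {V : Set} {L : Language V} → Decidable L → List (List V) → List V → List Bool
signature L? tests u = map (λ s → does (L? (u ++ s))) tests

state-determines-signature :
  {V : Set} {m : ℕ} {L : Language V} (A : DFA V m) (L? : Decidable L) → L ≐ Accepted A →
  ∀ tests {u v} → state A u ≡ state A v → signature L? tests u ≡ signature L? tests v
state-determines-signature A L? L≐A tests {u} {v} same = map-cong residual tests
  where
  open DFA A
  open ≡-Reasoning
  residual : ∀ s → does (L? (u ++ s)) ≡ does (L? (v ++ s))
  residual s = begin
    does (L? (u ++ s))             ≡⟨ accepts-does A L? L≐A (u ++ s) ⟩
    accept (state A (u ++ s))      ≡⟨ cong accept (state-++ A u s) ⟩
    accept (foldl δ (state A u) s) ≡⟨ cong (λ q → accept (foldl δ q s)) same ⟩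
    accept (foldl δ (state A v) s) ≡˘⟨ cong accept (state-++ A v s) ⟩
    accept (state A (v ++ s))      ≡˘⟨ accepts-does A L? L≐A (v ++ s) ⟩
    does (L? (v ++ s))             ∎

separated-words⇒¬REG :
  {V : Set} {n : ℕ} {L : Language V} (L? : Decidable L) (tests : List (List V))
  (words : Fin (suc n) → List V) → Injective _≡_ _≡_ (signature L? tests ∘ words) →
  ¬ REG n L
separated-words⇒¬REG L? tests words injective (m , m≤n , A , L≐A)
  with pigeonhole (s≤s m≤n) (state A ∘ words)
... | i , j , i<j , same =
  <⇒≢ i<j (injective (state-determines-signature A L? L≐A tests same))

InB? : Decidable InB
InB? a = yes (inj₁ refl)
InB? b = yes (inj₂ refl)
InB? c = no λ { (inj₁ ()) ; (inj₂ ()) }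

InI? : Decidable InI
InI? a = no λ { (inj₁ ()) ; (inj₂ ()) }
InI? b = yes (inj₁ refl)
InI? c = yes (inj₂ refl)

InE? : Decidable InE
InE? a = yes (inj₁ refl)
InE? b = no λ { (inj₁ ()) ; (inj₂ ()) }
InE? c = yes (inj₂ refl)

L2-tail? : Decidable L2-tail
L2-tail? []           = no λ ()
L2-tail? (y ∷ [])     = InE? y
L2-tail? (y ∷ z ∷ zs) = InI? y ×-dec L2-tail? (z ∷ zs)

L2? : Decidable L2
L2? []           = no λ ()
L2? (x ∷ [])     = InB? x ×-dec InE? x
L2? (x ∷ y ∷ zs) = InB? x ×-dec L2-tail? (y ∷ zs)

L2-tests : List (List Σ₃)
L2-tests = [] ∷ (a ∷ []) ∷ (c ∷ []) ∷ []

L2-words : Fin 5 → List Σ₃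
L2-words zero                         = []
L2-words (suc zero)                   = a ∷ []
L2-words (suc (suc zero))             = b ∷ []
L2-words (suc (suc (suc zero)))       = c ∷ []
L2-words (suc (suc (suc (suc zero)))) = a ∷ a ∷ []

L2-words-separated : Injective _≡_ _≡_ (signature L2? L2-tests ∘ L2-words)
L2-words-separated {i} {j} = from-yes
  (all? (λ i → all? (λ j →
    ≡-dec Bool._≟_ (sig i) (sig j) →-dec i ≟ j))) i j
  where sig = signature L2? L2-tests ∘ L2-words

L2∉REG₄ : ¬ REG 4 L2
L2∉REG₄ = separated-words⇒¬REG L2? L2-tests L2-words L2-words-separated

lemma2 : SLT 1 L2 × ¬ REG 4 L2
lemma2 = L2∈SLT₁ , L2∉REG₄
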